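{- Let $A,B\in T_n$ with $A\leq B$ in the Taskin weak order, and let $I$ be an interval of $\{1,\ldots,n\}$. Then $st(A\mid I)\leq st(B\mid I)$ in the Taskin weak order.
   Context: $T_n$ is the set of standard Young tableaux with entries $1,\ldots,n$; $P(\sigma)$ is the Robinson–Schensted insertion tableau of $\sigma\in S_n$. Permutations are words; the right weak order on $S_n$ is inclusion of inversion sets (an inversion of a word is a pair $(j,i)$, $j>i$, $j$ left of $i$). The Taskin weak order on $T_n$ is the transitive closure of: $U\leq V$ if there are $u\leq v$ in $S_n$ with $P(u)=U$, $P(v)=V$. For $\sigma\in S_n$ and $I\subseteq\{1,\ldots,n\}$, $\sigma\mid I$ is the word obtained by deleting letters not in $I$, and $st$ denotes standardization (replace letters by their images under the increasing bijection onto $\{1,\ldots,k\}$). For a tableau $A\in T_n$ and an interval $I$, $st(A\mid I):=P(st(u\mid I))$ for any $u$ with $P(u)=A$; this is well defined since plactic equivalence is compatible with restriction to intervals and standardization. -}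

module Defs where

open import Data.Nat using (ℕ; zero; suc; _<_; _≤_)
open import Data.Nat.Properties using (_≤?_; _<?_)
open import Data.Bool using (if_then_else_)
open import Data.Maybe using (Maybe; just; nothing)
open import Data.List using (List; []; _∷_; _++_; map; upTo; filter; length; foldl; concat)
open import Data.List.Membership.Propositional using (_∈_)
open import Data.List.Relation.Binary.Permutation.Propositional using (_↭_)
open import Data.List.Relation.Unary.All using (All)
open import Data.List.Relation.Unary.Linked using (Linked)
open import Data.Product using (_×_; _,_; ∃₂)
open import Data.Unit using (⊤)
open import Data.Empty using (⊥)
open import Relation.Binary.PropositionalEquality using (_≡_)
open import Relation.Nullary.Decidable using (⌊_⌋; _×-dec_)
open import Relation.Binary.Construct.Closure.Transitive using (TransClosure)

-- Words (permutations written in one-line notation) and tableaux (list of rows, top row first).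
Word : Set
Word = List ℕ

Tableau : Set
Tableau = List (List ℕ)

range : ℕ → List ℕ
range n = map suc (upTo n)

IsPerm : ℕ → Word → Set
IsPerm n w = w ↭ range n

Inv : Word → ℕ → ℕ → Set
Inv w j i = i < j × ∃₂ (λ xs ys → (w ≡ xs ++ j ∷ ys) × (i ∈ ys))

_≤w_ : Word → Word → Set
u ≤w v = ∀ j i → Inv u j i → Inv v j i

insertRow : ℕ → List ℕ → List ℕ × Maybe ℕ
insertRow x [] = (x ∷ []) , nothing
insertRow x (y ∷ r) with insertRow x r
... | (r' , m) = if ⌊ x <? y ⌋ then ((x ∷ r) , just y) else ((y ∷ r') , m)

insertT : ℕ → Tableau → Tableau
insertT x [] = (x ∷ []) ∷ []
insertT x (r ∷ t) with insertRow x r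
... | (r' , nothing) = r' ∷ t
... | (r' , just y) = r' ∷ insertT y t

P : Word → Tableau
P w = foldl (λ t x → insertT x t) [] w

Below : List ℕ → List ℕ → Set
Below _ [] = ⊤
Below [] (_ ∷ _) = ⊥
Below (x ∷ r) (y ∷ r') = (x < y) × Below r r'

NonEmptyRow : List ℕ → Set
NonEmptyRow r = 0 < length r

SYT : ℕ → Tableau → Set
SYT n t = All NonEmptyRow t × All (Linked _<_) t × Linked Below t × (concat t ↭ range n)

TaskinStep : ℕ → Tableau → Tableau → Set
TaskinStep n U V = ∃₂ (λ u v → IsPerm n u × IsPerm n v × (u ≤w v) × (P u ≡ U) × (P v ≡ V))

TaskinLeq : ℕ → Tableau → Tableau → Set
TaskinLeq n = TransClosure (TaskinStep n)

restrict : ℕ → ℕ → Word → Word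
restrict a b w = filter (λ x → (a ≤? x) ×-dec (x ≤? b)) w

st : Word → Word
st w = map (λ x → suc (length (filter (_<? x) w))) w

module Submission where

-- Row insertion of
-- Knuth-related words produces the same row and bumps out words that are equal or again
-- Knuth-related, so P respects ≈ᴷ; conversely every word is Knuth equivalent to the reading
-- word of its insertion tableau. Hence P u ≡ P v exactly when u ≈ᴷ v. Restriction to an
-- interval and standardization both preserve ≈ᴷ and inclusion of inversion sets, and they map
-- S_n onto S_(b+1-a). So every generating step P u₀ ≤ P v₀ of the Taskin order, with u₀ ≤ v₀
-- in the weak order, restricts to the step P (st (u₀ ∣ I)) ≤ P (st (v₀ ∣ I)), independently
-- of the representatives chosen, and the chain A ≤ B restricts link by link.

open import Defs
open import Data.Nat using (ℕ; zero; suc; _+_; _∸_; _<_; _≤_; z≤n; s≤s)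
open import Data.Nat.Properties
  using (_≤?_; _<?_; ≤-refl; ≤-trans; <-trans; ≤-<-trans; <-≤-trans; <⇒≤; <⇒≱; ≰⇒>; ≮⇒≥;
         <-≤-connex; <-irrefl; ≤-antisym; m≤n⇒m≤1+n; m<n⇒m<1+n; n≤1+n; m≤m+n; +-identityʳ; +-suc;
         +-∸-assoc; n∸n≡0; m≤n⇒m∸n≡0)
open import Data.Maybe using (just; nothing)
open import Data.List using (List; []; _∷_; _++_; foldl; fromMaybe; filter; map; length; applyUpTo)
open import Data.List.Membership.Propositional using (_∈_)
open import Data.List.Relation.Unary.Any using (here; there)
open import Data.List.Relation.Binary.Permutation.Propositional
  using (_↭_; prep; swap; ↭-refl; ↭-sym; ↭-trans; ↭-reflexive; ↭-isEquivalence)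
open import Data.List.Relation.Binary.Permutation.Propositional.Properties
  using (++⁺ˡ; ++⁺ʳ; All-resp-↭; filter-↭; ↭-length; map⁺)
open import Data.List.Properties
  using (foldl-++; ++-identityʳ; ++-assoc; filter-++; filter-accept; filter-reject; map-++; map-cong;
         ∷-injective; map-applyUpTo)
open import Data.List.Membership.Propositional.Properties
  using (∈-map⁺; ∈-map⁻; ∈-filter⁺; ∈-filter⁻; ∈-++⁺ʳ)
open import Data.List.Relation.Unary.All as All using (All; []; _∷_)
import Data.List.Relation.Unary.All.Properties as All
open import Data.List.Relation.Unary.AllPairs using (AllPairs; []; _∷_)
open import Data.Product using (_×_; _,_; proj₁; proj₂; ∃₂; Σ-syntax)
import Data.Product as Product
open import Data.Sum using (inj₁; inj₂)
open import Relation.Nullary using (Dec; yes; no; ¬_; contradiction)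
open import Function using (id; _∘_)
open import Relation.Nullary.Decidable using (_×-dec_)
open import Relation.Unary using (Decidable)
open import Relation.Nullary.Construct.Add.Supremum using (_⁺; [_])
open import Relation.Binary.Construct.Add.Supremum.NonStrict _≤_ using (_≤⁺_; [_]; _≤⊤⁺)
open import Relation.Binary.Construct.Add.Supremum.Strict _<_ using (_<⁺_; [_]; [_]<⊤⁺; <⁺-transʳ)
open import Relation.Binary.Construct.Closure.Reflexive using (ReflClosure; refl; [_]; reflexive)
open import Relation.Binary.Construct.Closure.Transitive using ([_]; _∷_)
open import Relation.Binary.Construct.Closure.Equivalence using (EqClosure; gmap; gfold; fold)
import Relation.Binary.Construct.Closure.Equivalence as EqClosure
import Relation.Binary.Reasoning.Setoid
open import Relation.Binary.Construct.Closure.ReflexiveTransitive using (ε; _◅_; _◅◅_)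
open import Relation.Binary.Construct.Closure.Symmetric using (fwd; bwd)
open import Relation.Binary.PropositionalEquality
  using (_≡_; refl; sym; trans; cong; cong₂; subst; subst₂; isEquivalence; module ≡-Reasoning)

-- Row insertion

RowsSorted : Tableau → Set
RowsSorted = All (AllPairs _≤_)

newRow : ℕ → List ℕ → List ℕ
newRow x r = proj₁ (insertRow x r)

-- The bumped letter lives in ℕ ⁺ = Maybe ℕ; ⊤⁺ (nothing bumped) behaves as +∞.
bumped : ℕ → List ℕ → ℕ ⁺
bumped x r = proj₂ (insertRow x r)

insertRow-< : ∀ {x y} r → x < y → insertRow x (y ∷ r) ≡ (x ∷ r , just y)
insertRow-< {x} {y} r x<y with insertRow x r | x <? y
... | _ | yes _ = refl
... | _ | no x≮y = contradiction x<y x≮y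

insertRow-≥ : ∀ {x y} r → y ≤ x → insertRow x (y ∷ r) ≡ (y ∷ newRow x r , bumped x r)
insertRow-≥ {x} {y} r y≤x with insertRow x r | x <? y
... | _ | yes x<y = contradiction y≤x (<⇒≱ x<y)
... | _ | no _ = refl

newRow-all : ∀ {P : ℕ → Set} {x} r → All P r → P x → All P (newRow x r)
newRow-all [] [] px = px ∷ []
newRow-all {x = x} (y ∷ r) (py ∷ pr) px with <-≤-connex x y
... | inj₁ x<y rewrite insertRow-< r x<y = px ∷ pr
... | inj₂ y≤x rewrite insertRow-≥ r y≤x = py ∷ newRow-all r pr px

bumped-lowerBound : ∀ {h x} r → All (h ≤_) r → [ h ] ≤⁺ bumped x r
bumped-lowerBound [] [] = _ ≤⊤⁺
bumped-lowerBound {x = x} (y ∷ r) (h≤y ∷ h≤r) with <-≤-connex x y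
... | inj₁ x<y rewrite insertRow-< r x<y = [ h≤y ]
... | inj₂ y≤x rewrite insertRow-≥ r y≤x = bumped-lowerBound r h≤r

bumped-> : ∀ x r → [ x ] <⁺ bumped x r
bumped-> x [] = [ x ]<⊤⁺
bumped-> x (y ∷ r) with <-≤-connex x y
... | inj₁ x<y rewrite insertRow-< r x<y = [ x<y ]
... | inj₂ y≤x rewrite insertRow-≥ r y≤x = bumped-> x r

newRow-sorted : ∀ {x} r → AllPairs _≤_ r → AllPairs _≤_ (newRow x r)
newRow-sorted [] [] = [] ∷ []
newRow-sorted {x} (y ∷ r) (y≤r ∷ sr) with <-≤-connex x y
... | inj₁ x<y rewrite insertRow-< r x<y = All.map (≤-trans (<⇒≤ x<y)) y≤r ∷ sr
... | inj₂ y≤x rewrite insertRow-≥ r y≤x = newRow-all r y≤r y≤x ∷ newRow-sorted r sr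

bumped-mono : ∀ {y z} r → AllPairs _≤_ r → y ≤ z → bumped y r ≤⁺ bumped z (newRow y r)
bumped-mono [] [] y≤z rewrite insertRow-≥ [] y≤z = _ ≤⊤⁺
bumped-mono {y} {z} (c ∷ r) (c≤r ∷ sr) y≤z with <-≤-connex y c
... | inj₁ y<c rewrite insertRow-< r y<c | insertRow-≥ r y≤z = bumped-lowerBound r c≤r
... | inj₂ c≤y rewrite insertRow-≥ r c≤y | insertRow-≥ (newRow y r) (≤-trans c≤y y≤z) =
  bumped-mono r sr y≤z

bumped-strict : ∀ {y z} r → AllPairs _≤_ r → y < z → bumped y (newRow z r) <⁺ bumped z r
bumped-strict [] [] y<z rewrite insertRow-< [] y<z = [ _ ]<⊤⁺
bumped-strict {y} {z} (c ∷ r) (_ ∷ sr) y<z with <-≤-connex z c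
... | inj₁ z<c rewrite insertRow-< r z<c | insertRow-< r y<z = [ z<c ]
... | inj₂ c≤z rewrite insertRow-≥ r c≤z with <-≤-connex y c
...   | inj₁ y<c rewrite insertRow-< (newRow z r) y<c = <⁺-transʳ ≤-<-trans [ c≤z ] (bumped-> z r)
...   | inj₂ c≤y rewrite insertRow-≥ (newRow z r) c≤y = bumped-strict r sr y<z

-- Knuth moves and insertion

insertWord : Tableau → Word → Tableau
insertWord = foldl (λ t x → insertT x t)

insertT-∷ : ∀ x r t → insertT x (r ∷ t) ≡ newRow x r ∷ insertWord t (fromMaybe (bumped x r))
insertT-∷ x r t with insertRow x r
... | (_ , nothing) = refl
... | (_ , just _) = refl

insertT-sorted : ∀ x t → RowsSorted t → RowsSorted (insertT x t)
insertT-sorted x [] [] = ([] ∷ []) ∷ []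
insertT-sorted x (r ∷ t) (sr ∷ st) rewrite insertT-∷ x r t with bumped x r
... | nothing = newRow-sorted r sr ∷ st
... | just y = newRow-sorted r sr ∷ insertT-sorted y t st

insertWord-sorted : ∀ t w → RowsSorted t → RowsSorted (insertWord t w)
insertWord-sorted t [] st = st
insertWord-sorted t (x ∷ w) st = insertWord-sorted (insertT x t) w (insertT-sorted x t st)

rowAfter : Word → List ℕ → List ℕ
rowAfter [] r = r
rowAfter (x ∷ w) r = rowAfter w (newRow x r)

bumpedWord : Word → List ℕ → Word
bumpedWord [] r = []
bumpedWord (x ∷ w) r = fromMaybe (bumped x r) ++ bumpedWord w (newRow x r)

insertWord-++ : ∀ t u v → insertWord t (u ++ v) ≡ insertWord (insertWord t u) v
insertWord-++ = foldl-++ _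

insertWord-∷ : ∀ r t w → insertWord (r ∷ t) w ≡ rowAfter w r ∷ insertWord t (bumpedWord w r)
insertWord-∷ r t [] = refl
insertWord-∷ r t (x ∷ w) = begin
  insertWord (insertT x (r ∷ t)) w
    ≡⟨ cong (λ t′ → insertWord t′ w) (insertT-∷ x r t) ⟩
  insertWord (newRow x r ∷ insertWord t (fromMaybe (bumped x r))) w
    ≡⟨ insertWord-∷ (newRow x r) _ w ⟩
  rowAfter w (newRow x r) ∷ insertWord (insertWord t (fromMaybe (bumped x r))) (bumpedWord w (newRow x r))
    ≡⟨ cong (rowAfter w (newRow x r) ∷_) (sym (insertWord-++ t (fromMaybe (bumped x r)) _)) ⟩
  rowAfter w (newRow x r) ∷ insertWord t (bumpedWord (x ∷ w) r) ∎
  where open ≡-Reasoning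

rowAfter-pass : ∀ {h} r w → All (h ≤_) w → rowAfter w (h ∷ r) ≡ h ∷ rowAfter w r
rowAfter-pass r [] [] = refl
rowAfter-pass r (x ∷ w) (h≤x ∷ h≤w) rewrite insertRow-≥ r h≤x = rowAfter-pass (newRow x r) w h≤w

bumpedWord-pass : ∀ {h} r w → All (h ≤_) w → bumpedWord w (h ∷ r) ≡ bumpedWord w r
bumpedWord-pass r [] [] = refl
bumpedWord-pass r (x ∷ w) (h≤x ∷ h≤w) rewrite insertRow-≥ r h≤x =
  cong (fromMaybe (bumped x r) ++_) (bumpedWord-pass (newRow x r) w h≤w)

data KnuthMove : Word → Word → Set where
  knuth₁ : ∀ {x y z} → x < y → y ≤ z → KnuthMove (y ∷ z ∷ x ∷ []) (y ∷ x ∷ z ∷ [])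
  knuth₂ : ∀ {x y z} → x ≤ y → y < z → KnuthMove (x ∷ z ∷ y ∷ []) (z ∷ x ∷ y ∷ [])

InsertsAlike : List ℕ → Word → Word → Set
InsertsAlike r s s′ = rowAfter s r ≡ rowAfter s′ r × ReflClosure KnuthMove (bumpedWord s r) (bumpedWord s′ r)

-- Knuth moves some of whose letters may be missing (bumped as ⊤⁺).
knuth₁⁺ : ∀ {x m₁ m₂} → [ x ] <⁺ m₁ → m₁ ≤⁺ m₂ →
  ReflClosure KnuthMove (fromMaybe m₁ ++ fromMaybe m₂ ++ x ∷ []) (fromMaybe m₁ ++ x ∷ fromMaybe m₂)
knuth₁⁺ [ x<y ] [ y≤z ] = [ knuth₁ x<y y≤z ]
knuth₁⁺ _ (_ ≤⊤⁺) = refl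

knuth₂⁺ : ∀ {x m₁ m₂} → [ x ] ≤⁺ m₁ → m₁ <⁺ m₂ →
  ReflClosure KnuthMove (x ∷ fromMaybe m₂ ++ fromMaybe m₁) (fromMaybe m₂ ++ x ∷ fromMaybe m₁)
knuth₂⁺ [ x≤y ] [ y<z ] = [ knuth₂ x≤y y<z ]
knuth₂⁺ _ [ _ ]<⊤⁺ = refl

knuthMove-emptyRow : ∀ {s s′} → KnuthMove s s′ →
  rowAfter s [] ≡ rowAfter s′ [] × bumpedWord s [] ≡ bumpedWord s′ []
knuthMove-emptyRow (knuth₁ {x} {y} {z} x<y y≤z)
  rewrite insertRow-≥ [] y≤z | insertRow-< (z ∷ []) x<y | insertRow-< [] x<y
        | insertRow-≥ [] (≤-trans (<⇒≤ x<y) y≤z) = refl , refl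
knuthMove-emptyRow (knuth₂ {x} {y} {z} x≤y y<z)
  rewrite insertRow-≥ [] (≤-trans x≤y (<⇒≤ y<z)) | insertRow-≥ (z ∷ []) x≤y | insertRow-< [] y<z
        | insertRow-< [] (≤-<-trans x≤y y<z) | insertRow-≥ [] x≤y = refl , refl

insertsAlike-pass : ∀ {h r s s′} → All (h ≤_) s → All (h ≤_) s′ →
  InsertsAlike r s s′ → InsertsAlike (h ∷ r) s s′
insertsAlike-pass {r = r} {s} {s′} h≤s h≤s′ (row≡ , bumped≈)
  rewrite rowAfter-pass r s h≤s | rowAfter-pass r s′ h≤s′
        | bumpedWord-pass r s h≤s | bumpedWord-pass r s′ h≤s′ =
  cong (_ ∷_) row≡ , bumped≈

knuth₁-x<h≤y : ∀ {h r x y z} → AllPairs _≤_ r → x < y → y ≤ z → x < h → h ≤ y →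
  InsertsAlike (h ∷ r) (y ∷ z ∷ x ∷ []) (y ∷ x ∷ z ∷ [])
knuth₁-x<h≤y {h} {r} {x} {y} {z} sr x<y y≤z x<h h≤y
  rewrite insertRow-≥ r h≤y | insertRow-≥ (newRow y r) (≤-trans h≤y y≤z)
        | insertRow-< (newRow z (newRow y r)) x<h | insertRow-< (newRow y r) x<h
        | insertRow-≥ (newRow y r) (≤-trans (<⇒≤ x<y) y≤z) | ++-identityʳ (fromMaybe (bumped z (newRow y r))) =
  refl , knuth₁⁺ (<⁺-transʳ ≤-<-trans [ h≤y ] (bumped-> y r)) (bumped-mono r sr y≤z)

knuth₁-y<h : ∀ {h r x y z} → All (h ≤_) r → x < y → y ≤ z → y < h →
  InsertsAlike (h ∷ r) (y ∷ z ∷ x ∷ []) (y ∷ x ∷ z ∷ [])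
knuth₁-y<h {h} {r} {x} {y} {z} h≤r x<y y≤z y<h
  rewrite insertRow-< r y<h | insertRow-≥ r y≤z | insertRow-< (newRow z r) x<y | insertRow-< r x<y
        | insertRow-≥ r (≤-trans (<⇒≤ x<y) y≤z) | ++-identityʳ (fromMaybe (bumped z r)) =
  refl , knuth₁⁺ [ y<h ] (bumped-lowerBound r h≤r)

knuth₂-x<h≤z : ∀ {h r x y z} → AllPairs _≤_ r → All (h ≤_) r → x ≤ y → y < z → x < h → h ≤ z →
  InsertsAlike (h ∷ r) (x ∷ z ∷ y ∷ []) (z ∷ x ∷ y ∷ [])
knuth₂-x<h≤z {h} {r} {x} {y} {z} sr h≤r x≤y y<z x<h h≤z
  rewrite insertRow-< r x<h | insertRow-≥ r (≤-trans x≤y (<⇒≤ y<z))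
        | insertRow-≥ r h≤z | insertRow-< (newRow z r) x<h | insertRow-≥ (newRow z r) x≤y
        | ++-identityʳ (fromMaybe (bumped y (newRow z r))) =
  refl , knuth₂⁺ (bumped-lowerBound (newRow z r) (newRow-all r h≤r h≤z)) (bumped-strict r sr y<z)

knuth₂-z<h : ∀ {h r x y z} → All (h ≤_) r → x ≤ y → y < z → z < h →
  InsertsAlike (h ∷ r) (x ∷ z ∷ y ∷ []) (z ∷ x ∷ y ∷ [])
knuth₂-z<h {h} {r} {x} {y} {z} h≤r x≤y y<z z<h
  rewrite insertRow-< r (≤-<-trans x≤y (<-trans y<z z<h)) | insertRow-≥ r (≤-trans x≤y (<⇒≤ y<z))
        | insertRow-≥ (newRow z r) x≤y | insertRow-< r z<h | insertRow-< r (≤-<-trans x≤y y<z)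
        | insertRow-≥ r x≤y with r | h≤r
... | [] | [] rewrite insertRow-< [] y<z = refl , refl
... | c ∷ r′ | h≤c ∷ _
  rewrite insertRow-< r′ (<-≤-trans z<h h≤c) | insertRow-< r′ y<z
        | insertRow-< r′ (<-trans y<z (<-≤-trans z<h h≤c)) = refl , [ knuth₁ z<h h≤c ]

knuthMove-alike : ∀ {r s s′} → AllPairs _≤_ r → KnuthMove s s′ → InsertsAlike r s s′
knuthMove-alike [] m = Product.map₂ reflexive (knuthMove-emptyRow m)
knuthMove-alike {h ∷ r} (h≤r ∷ sr) (knuth₁ {x} {y} {z} x<y y≤z) with <-≤-connex x h | <-≤-connex y h
... | inj₂ h≤x | _ =
  let h≤y = ≤-trans h≤x (<⇒≤ x<y) ; h≤z = ≤-trans h≤y y≤z in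
  insertsAlike-pass (h≤y ∷ h≤z ∷ h≤x ∷ []) (h≤y ∷ h≤x ∷ h≤z ∷ [])
    (knuthMove-alike sr (knuth₁ x<y y≤z))
... | inj₁ x<h | inj₂ h≤y = knuth₁-x<h≤y sr x<y y≤z x<h h≤y
... | inj₁ _ | inj₁ y<h = knuth₁-y<h h≤r x<y y≤z y<h
knuthMove-alike {h ∷ r} (h≤r ∷ sr) (knuth₂ {x} {y} {z} x≤y y<z) with <-≤-connex x h | <-≤-connex z h
... | inj₂ h≤x | _ =
  let h≤y = ≤-trans h≤x x≤y ; h≤z = ≤-trans h≤y (<⇒≤ y<z) in
  insertsAlike-pass (h≤x ∷ h≤z ∷ h≤y ∷ []) (h≤z ∷ h≤x ∷ h≤y ∷ [])
    (knuthMove-alike sr (knuth₂ x≤y y<z))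
... | inj₁ x<h | inj₂ h≤z = knuth₂-x<h≤z sr h≤r x≤y y<z x<h h≤z
... | inj₁ _ | inj₁ z<h = knuth₂-z<h h≤r x≤y y<z z<h

insertWord-∷-cong : ∀ r t {s s′} → rowAfter s r ≡ rowAfter s′ r →
  insertWord t (bumpedWord s r) ≡ insertWord t (bumpedWord s′ r) →
  insertWord (r ∷ t) s ≡ insertWord (r ∷ t) s′
insertWord-∷-cong r t {s} {s′} row≡ rest≡ = begin
  insertWord (r ∷ t) s                              ≡⟨ insertWord-∷ r t s ⟩
  rowAfter s r ∷ insertWord t (bumpedWord s r)      ≡⟨ cong₂ _∷_ row≡ rest≡ ⟩
  rowAfter s′ r ∷ insertWord t (bumpedWord s′ r)    ≡⟨ sym (insertWord-∷ r t s′) ⟩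
  insertWord (r ∷ t) s′                             ∎
  where open ≡-Reasoning

insertWord-knuth : ∀ {t s s′} → RowsSorted t → KnuthMove s s′ → insertWord t s ≡ insertWord t s′
insertWord-knuth⁼ : ∀ {t u v} → RowsSorted t → ReflClosure KnuthMove u v → insertWord t u ≡ insertWord t v

insertWord-knuth {r ∷ t} {s} {s′} (sr ∷ st) m =
  let row≡ , bumped≈ = knuthMove-alike sr m in
  insertWord-∷-cong r t {s} {s′} row≡ (insertWord-knuth⁼ st bumped≈)
-- On nonempty words, insertion into [] and into [] ∷ [] agree definitionally.
insertWord-knuth {s = s} {s′} [] m@(knuth₁ _ _) = let row≡ , bumped≡ = knuthMove-emptyRow m in
  insertWord-∷-cong [] [] {s} {s′} row≡ (cong (insertWord []) bumped≡)
insertWord-knuth {s = s} {s′} [] m@(knuth₂ _ _) = let row≡ , bumped≡ = knuthMove-emptyRow m in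
  insertWord-∷-cong [] [] {s} {s′} row≡ (cong (insertWord []) bumped≡)

insertWord-knuth⁼ st refl = refl
insertWord-knuth⁼ st [ m ] = insertWord-knuth st m

-- Knuth equivalence and the reading word

data KnuthStep : Word → Word → Set where
  knuthStep : ∀ p q {s s′} → KnuthMove s s′ → KnuthStep (p ++ s ++ q) (p ++ s′ ++ q)

infix 4 _≈ᴷ_
_≈ᴷ_ : Word → Word → Set
_≈ᴷ_ = EqClosure KnuthStep

module ≈ᴷ-Reasoning = Relation.Binary.Reasoning.Setoid (EqClosure.setoid KnuthStep)

knuth-≈ᴷ : ∀ p q {s s′} → KnuthMove s s′ → p ++ s ++ q ≈ᴷ p ++ s′ ++ q
knuth-≈ᴷ p q m = EqClosure.return (knuthStep p q m)

knuth⁼-≈ᴷ : ∀ p q {s s′} → ReflClosure KnuthMove s s′ → p ++ s ++ q ≈ᴷ p ++ s′ ++ q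
knuth⁼-≈ᴷ p q refl = ε
knuth⁼-≈ᴷ p q [ m ] = knuth-≈ᴷ p q m

≈ᴷ-++ˡ : ∀ p {u v} → u ≈ᴷ v → p ++ u ≈ᴷ p ++ v
≈ᴷ-++ˡ p = gmap (p ++_) prefix
  where
  prefix : ∀ {u v} → KnuthStep u v → KnuthStep (p ++ u) (p ++ v)
  prefix (knuthStep p′ q m) = subst₂ KnuthStep (++-assoc p p′ _) (++-assoc p p′ _) (knuthStep (p ++ p′) q m)

≈ᴷ-++ʳ : ∀ q {u v} → u ≈ᴷ v → u ++ q ≈ᴷ v ++ q
≈ᴷ-++ʳ q = gmap (_++ q) suffix
  where
  reassoc : ∀ p s q′ → p ++ s ++ (q′ ++ q) ≡ (p ++ s ++ q′) ++ q
  reassoc p s q′ = trans (cong (p ++_) (sym (++-assoc s q′ q))) (sym (++-assoc p (s ++ q′) q))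
  suffix : ∀ {u v} → KnuthStep u v → KnuthStep (u ++ q) (v ++ q)
  suffix (knuthStep p q′ {s} {s′} m) =
    subst₂ KnuthStep (reassoc p s q′) (reassoc p s′ q′) (knuthStep p (q′ ++ q) m)

P-sorted : ∀ w → RowsSorted (P w)
P-sorted w = insertWord-sorted [] w []

P-KnuthStep : ∀ {u v} → KnuthStep u v → P u ≡ P v
P-KnuthStep (knuthStep p q {s} {s′} m) = begin
  P (p ++ s ++ q)                          ≡⟨ insertWord-++ [] p (s ++ q) ⟩
  insertWord (P p) (s ++ q)                ≡⟨ insertWord-++ (P p) s q ⟩
  insertWord (insertWord (P p) s) q        ≡⟨ cong (λ t → insertWord t q) (insertWord-knuth (P-sorted p) m) ⟩
  insertWord (insertWord (P p) s′) q       ≡⟨ sym (insertWord-++ (P p) s′ q) ⟩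
  insertWord (P p) (s′ ++ q)               ≡⟨ sym (insertWord-++ [] p (s′ ++ q)) ⟩
  P (p ++ s′ ++ q)                         ∎
  where open ≡-Reasoning

P-≈ᴷ : ∀ {u v} → u ≈ᴷ v → P u ≡ P v
P-≈ᴷ = gfold isEquivalence P P-KnuthStep

AllPairs-++⁻ˡ : ∀ {A : Set} {R : A → A → Set} u {v} → AllPairs R (u ++ v) → AllPairs R u
AllPairs-++⁻ˡ [] _ = []
AllPairs-++⁻ˡ (x ∷ u) (x~ ∷ s) = All.++⁻ˡ u x~ ∷ AllPairs-++⁻ˡ u s

AllPairs-++⁻ʳ : ∀ {A : Set} {R : A → A → Set} u {v} → AllPairs R (u ++ v) → AllPairs R v
AllPairs-++⁻ʳ [] s = s
AllPairs-++⁻ʳ (x ∷ u) (_ ∷ s) = AllPairs-++⁻ʳ u s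

knuth₁-slide : ∀ {x c} r → x < c → All (c ≤_) r → AllPairs _≤_ r → c ∷ r ++ x ∷ [] ≈ᴷ c ∷ x ∷ r
knuth₁-slide [] _ _ _ = ε
knuth₁-slide {x} {c} (d ∷ r) x<c (c≤d ∷ _) (d≤r ∷ sr) =
  ≈ᴷ-++ˡ (c ∷ []) (knuth₁-slide r (<-≤-trans x<c c≤d) d≤r sr) ◅◅ knuth-≈ᴷ [] r (knuth₁ x<c c≤d)

knuth₂-slide : ∀ {a b} u rest → AllPairs _≤_ u → All (_≤ a) u → a < b →
  u ++ b ∷ a ∷ rest ≈ᴷ b ∷ u ++ a ∷ rest
knuth₂-slide [] rest _ _ _ = ε
knuth₂-slide (e ∷ []) rest _ (e≤a ∷ []) a<b = knuth-≈ᴷ [] rest (knuth₂ e≤a a<b)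
knuth₂-slide (e ∷ f ∷ u) rest (e≤fu ∷ sfu) (_ ∷ f≤a ∷ u≤a) a<b =
  ≈ᴷ-++ˡ (e ∷ []) (knuth₂-slide (f ∷ u) rest sfu (f≤a ∷ u≤a) a<b)
  ◅◅ knuth-≈ᴷ [] (u ++ _ ∷ rest) (knuth₂ (All.head e≤fu) (≤-<-trans f≤a a<b))

rowInsertion-≈ᴷ : ∀ {x} u r → AllPairs _≤_ (u ++ r) → All (_≤ x) u →
  u ++ r ++ x ∷ [] ≈ᴷ fromMaybe (bumped x r) ++ u ++ newRow x r
rowInsertion-≈ᴷ u [] _ _ = ε
rowInsertion-≈ᴷ {x} u (c ∷ r) s u≤x with <-≤-connex x c | AllPairs-++⁻ʳ u s
... | inj₁ x<c | c≤r ∷ sr rewrite insertRow-< r x<c =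
  ≈ᴷ-++ˡ u (knuth₁-slide r x<c c≤r sr) ◅◅ knuth₂-slide u r (AllPairs-++⁻ˡ u s) u≤x x<c
... | inj₂ c≤x | _ rewrite insertRow-≥ r c≤x = begin
  u ++ c ∷ r ++ x ∷ []
    ≡⟨ ++-assoc u (c ∷ []) _ ⟨
  (u ++ c ∷ []) ++ r ++ x ∷ []
    ≈⟨ rowInsertion-≈ᴷ (u ++ c ∷ []) r s′ (All.++⁺ u≤x (c≤x ∷ [])) ⟩
  fromMaybe (bumped x r) ++ (u ++ c ∷ []) ++ newRow x r
    ≡⟨ cong (fromMaybe (bumped x r) ++_) (++-assoc u (c ∷ []) _) ⟩
  fromMaybe (bumped x r) ++ u ++ c ∷ newRow x r ∎
  where
  open ≈ᴷ-Reasoning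
  s′ : AllPairs _≤_ ((u ++ c ∷ []) ++ r)
  s′ = subst (AllPairs _≤_) (sym (++-assoc u (c ∷ []) r)) s

read : Tableau → Word
read [] = []
read (r ∷ t) = read t ++ r

read-insertT : ∀ x t → RowsSorted t → read t ++ x ∷ [] ≈ᴷ read (insertT x t)
read-insertT x [] [] = ε
read-insertT x (r ∷ t) (sr ∷ st) = begin
  (read t ++ r) ++ x ∷ []                                     ≡⟨ ++-assoc (read t) r _ ⟩
  read t ++ r ++ x ∷ []                                       ≈⟨ ≈ᴷ-++ˡ (read t) (rowInsertion-≈ᴷ [] r sr []) ⟩
  read t ++ fromMaybe (bumped x r) ++ newRow x r              ≡⟨ ++-assoc (read t) _ _ ⟨
  (read t ++ fromMaybe (bumped x r)) ++ newRow x r            ≈⟨ ≈ᴷ-++ʳ (newRow x r) (read-bumped (bumped x r)) ⟩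
  read (insertWord t (fromMaybe (bumped x r))) ++ newRow x r  ≡⟨ cong read (insertT-∷ x r t) ⟨
  read (insertT x (r ∷ t))                                    ∎
  where
  open ≈ᴷ-Reasoning
  read-bumped : ∀ m → read t ++ fromMaybe m ≈ᴷ read (insertWord t (fromMaybe m))
  read-bumped nothing = subst (_≈ᴷ read t) (sym (++-identityʳ (read t))) ε
  read-bumped (just y) = read-insertT y t st

read-insertWord : ∀ t w → RowsSorted t → read t ++ w ≈ᴷ read (insertWord t w)
read-insertWord t [] _ = subst (_≈ᴷ read t) (sym (++-identityʳ (read t))) ε
read-insertWord t (x ∷ w) st = begin
  read t ++ x ∷ w                      ≡⟨ ++-assoc (read t) (x ∷ []) w ⟨
  (read t ++ x ∷ []) ++ w              ≈⟨ ≈ᴷ-++ʳ w (read-insertT x t st) ⟩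
  read (insertT x t) ++ w              ≈⟨ read-insertWord (insertT x t) w (insertT-sorted x t st) ⟩
  read (insertWord (insertT x t) w)    ∎
  where open ≈ᴷ-Reasoning

P-≡⇒≈ᴷ : ∀ {u v} → P u ≡ P v → u ≈ᴷ v
P-≡⇒≈ᴷ {u} {v} P≡ = begin
  u             ≈⟨ read-insertWord [] u [] ⟩
  read (P u)    ≡⟨ cong read P≡ ⟩
  read (P v)    ≈⟨ read-insertWord [] v [] ⟨
  v             ∎
  where open ≈ᴷ-Reasoning

-- Restriction and standardization

InInterval : ℕ → ℕ → ℕ → Set
InInterval a b x = a ≤ x × x ≤ b

inInterval? : ∀ a b → Decidable (InInterval a b)
inInterval? a b x = (a ≤? x) ×-dec (x ≤? b)

keep : ∀ {P : Set} → ℕ → Dec P → Word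
keep x (yes _) = x ∷ []
keep x (no _) = []

restrict-∷ : ∀ a b x w → restrict a b (x ∷ w) ≡ keep x (inInterval? a b x) ++ restrict a b w
restrict-∷ a b x w with inInterval? a b x
... | yes x∈I = filter-accept (inInterval? a b) x∈I
... | no x∉I = filter-reject (inInterval? a b) x∉I

-- If both swapped letters lie in the interval, so does the middle one; otherwise the move disappears.
restrict-KnuthMove : ∀ a b {s s′} → KnuthMove s s′ → ReflClosure KnuthMove (restrict a b s) (restrict a b s′)
restrict-KnuthMove a b (knuth₁ {x} {y} {z} x<y y≤z)
  rewrite restrict-∷ a b y (z ∷ x ∷ []) | restrict-∷ a b z (x ∷ []) | restrict-∷ a b y (x ∷ z ∷ [])
        | restrict-∷ a b x (z ∷ []) | restrict-∷ a b x [] | restrict-∷ a b z []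
  with inInterval? a b z | inInterval? a b x
... | no _ | _ = refl
... | yes _ | no _ = refl
... | yes (_ , z≤b) | yes (a≤x , _) with inInterval? a b y
...   | yes _ = [ knuth₁ x<y y≤z ]
...   | no y∉I = contradiction (≤-trans a≤x (<⇒≤ x<y) , ≤-trans y≤z z≤b) y∉I
restrict-KnuthMove a b (knuth₂ {x} {y} {z} x≤y y<z)
  rewrite restrict-∷ a b x (z ∷ y ∷ []) | restrict-∷ a b z (y ∷ []) | restrict-∷ a b z (x ∷ y ∷ [])
        | restrict-∷ a b x (y ∷ []) | restrict-∷ a b y []
  with inInterval? a b x | inInterval? a b z
... | no _ | _ = refl
... | yes _ | no _ = refl
... | yes (a≤x , _) | yes (_ , z≤b) with inInterval? a b y
...   | yes _ = [ knuth₂ x≤y y<z ]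
...   | no y∉I = contradiction (≤-trans a≤x x≤y , ≤-trans (<⇒≤ y<z) z≤b) y∉I

restrict-++ : ∀ a b p s q → restrict a b (p ++ s ++ q) ≡ restrict a b p ++ restrict a b s ++ restrict a b q
restrict-++ a b p s q =
  trans (filter-++ (inInterval? a b) p (s ++ q)) (cong (restrict a b p ++_) (filter-++ (inInterval? a b) s q))

restrict-≈ᴷ : ∀ a b {u v} → u ≈ᴷ v → restrict a b u ≈ᴷ restrict a b v
restrict-≈ᴷ a b = gfold (EqClosure.isEquivalence KnuthStep) (restrict a b) restrict-KnuthStep
  where
  restrict-KnuthStep : ∀ {u v} → KnuthStep u v → restrict a b u ≈ᴷ restrict a b v
  restrict-KnuthStep (knuthStep p q {s} {s′} m) =
    subst₂ _≈ᴷ_ (sym (restrict-++ a b p s q)) (sym (restrict-++ a b p s′ q))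
      (knuth⁼-≈ᴷ (restrict a b p) (restrict a b q) (restrict-KnuthMove a b m))

KnuthStep⇒↭ : ∀ {u v} → KnuthStep u v → u ↭ v
KnuthStep⇒↭ (knuthStep p q m) = ++⁺ˡ p (++⁺ʳ q (move⇒↭ m))
  where
  move⇒↭ : ∀ {s s′} → KnuthMove s s′ → s ↭ s′
  move⇒↭ (knuth₁ {x} {y} {z} _ _) = prep y (swap z x ↭-refl)
  move⇒↭ (knuth₂ {x} {y} {z} _ _) = swap x z ↭-refl

≈ᴷ⇒↭ : ∀ {u v} → u ≈ᴷ v → u ↭ v
≈ᴷ⇒↭ = fold ↭-isEquivalence KnuthStep⇒↭

module _ {f : ℕ → ℕ} {W : Word} (mono : ∀ {x y} → x ≤ y → f x ≤ f y)
         (strict : ∀ {x y} → x ∈ W → x < y → f x < f y) where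

  map-KnuthMove : ∀ {s s′} → All (_∈ W) s → KnuthMove s s′ → KnuthMove (map f s) (map f s′)
  map-KnuthMove (_ ∷ _ ∷ x∈W ∷ []) (knuth₁ x<y y≤z) = knuth₁ (strict x∈W x<y) (mono y≤z)
  map-KnuthMove (_ ∷ _ ∷ y∈W ∷ []) (knuth₂ x≤y y<z) = knuth₂ (mono x≤y) (strict y∈W y<z)

  map-KnuthStep : ∀ {u v} → All (_∈ W) u → KnuthStep u v → KnuthStep (map f u) (map f v)
  map-KnuthStep u∈W (knuthStep p q {s} {s′} m) =
    subst₂ KnuthStep (sym (map-++₃ s)) (sym (map-++₃ s′))
      (knuthStep (map f p) (map f q) (map-KnuthMove (All.++⁻ˡ s (All.++⁻ʳ p u∈W)) m))
    where
    map-++₃ : ∀ s → map f (p ++ s ++ q) ≡ map f p ++ map f s ++ map f q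
    map-++₃ s = trans (map-++ f p (s ++ q)) (cong (map f p ++_) (map-++ f s q))

  map-≈ᴷ : ∀ {u v} → All (_∈ W) u → u ≈ᴷ v → map f u ≈ᴷ map f v
  map-≈ᴷ _ ε = ε
  map-≈ᴷ u∈W (fwd step ◅ rest) =
    fwd (map-KnuthStep u∈W step) ◅ map-≈ᴷ (All-resp-↭ (KnuthStep⇒↭ step) u∈W) rest
  map-≈ᴷ u∈W (bwd step ◅ rest) =
    let v∈W = All-resp-↭ (↭-sym (KnuthStep⇒↭ step)) u∈W in
    bwd (map-KnuthStep v∈W step) ◅ map-≈ᴷ v∈W rest

rank : Word → ℕ → ℕ
rank w x = suc (length (filter (_<? x) w))

rank-∷-< : ∀ {c x} w → c < x → rank (c ∷ w) x ≡ suc (rank w x)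
rank-∷-< {x = x} w c<x = cong (suc ∘ length) (filter-accept (_<? x) c<x)

rank-∷-≮ : ∀ {c x} w → ¬ c < x → rank (c ∷ w) x ≡ rank w x
rank-∷-≮ {x = x} w c≮x = cong (suc ∘ length) (filter-reject (_<? x) c≮x)

rank-mono : ∀ w {x y} → x ≤ y → rank w x ≤ rank w y
rank-mono [] _ = s≤s z≤n
rank-mono (c ∷ w) {x} {y} x≤y with c <? x | c <? y
... | yes c<x | yes c<y rewrite rank-∷-< w c<x | rank-∷-< w c<y = s≤s (rank-mono w x≤y)
... | yes c<x | no c≮y = contradiction (<-≤-trans c<x x≤y) c≮y
... | no c≮x | yes c<y rewrite rank-∷-≮ w c≮x | rank-∷-< w c<y = m≤n⇒m≤1+n (rank-mono w x≤y)
... | no c≮x | no c≮y rewrite rank-∷-≮ w c≮x | rank-∷-≮ w c≮y = rank-mono w x≤y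

rank-strict : ∀ w {x y} → x ∈ w → x < y → rank w x < rank w y
rank-strict (x ∷ w) (here refl) x<y
  rewrite rank-∷-≮ {x} {x} w (<-irrefl refl) | rank-∷-< w x<y = s≤s (rank-mono w (<⇒≤ x<y))
rank-strict (c ∷ w) {x} {y} (there x∈w) x<y with c <? x | c <? y
... | yes c<x | yes c<y rewrite rank-∷-< w c<x | rank-∷-< w c<y = s≤s (rank-strict w x∈w x<y)
... | yes c<x | no c≮y = contradiction (<-trans c<x x<y) c≮y
... | no c≮x | yes c<y rewrite rank-∷-≮ w c≮x | rank-∷-< w c<y = m<n⇒m<1+n (rank-strict w x∈w x<y)
... | no c≮x | no c≮y rewrite rank-∷-≮ w c≮x | rank-∷-≮ w c≮y = rank-strict w x∈w x<y

rank-↭ : ∀ {w w′} → w ↭ w′ → ∀ x → rank w x ≡ rank w′ x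
rank-↭ w↭w′ x = cong suc (↭-length (filter-↭ (_<? x) w↭w′))

st-≈ᴷ : ∀ {u v} → u ≈ᴷ v → st u ≈ᴷ st v
st-≈ᴷ {u} {v} u≈v =
  subst (st u ≈ᴷ_) (map-cong (rank-↭ (≈ᴷ⇒↭ u≈v)) v)
    (map-≈ᴷ (rank-mono u) (rank-strict u) (All.tabulate id) u≈v)

P-st-restrict : ∀ a b u v → P u ≡ P v → P (st (restrict a b u)) ≡ P (st (restrict a b v))
P-st-restrict a b u v P≡ = P-≈ᴷ (st-≈ᴷ (restrict-≈ᴷ a b (P-≡⇒≈ᴷ {u} {v} P≡)))

-- Inversions

map-split : ∀ (f : ℕ → ℕ) w xs j ys → map f w ≡ xs ++ j ∷ ys →
  Σ[ xs′ ∈ Word ] Σ[ j′ ∈ ℕ ] Σ[ ys′ ∈ Word ] w ≡ xs′ ++ j′ ∷ ys′ × f j′ ≡ j × map f ys′ ≡ ys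
map-split f (c ∷ w) [] j ys eq = [] , c , w , refl , proj₁ (∷-injective eq) , proj₂ (∷-injective eq)
map-split f (c ∷ w) (x ∷ xs) j ys eq with map-split f w xs j ys (proj₂ (∷-injective eq))
... | xs′ , j′ , ys′ , refl , fj′ , fys′ = c ∷ xs′ , j′ , ys′ , refl , fj′ , fys′

filter-split : ∀ {Q : ℕ → Set} (Q? : Decidable Q) w xs j ys → filter Q? w ≡ xs ++ j ∷ ys →
  Σ[ xs′ ∈ Word ] Σ[ ys′ ∈ Word ] w ≡ xs′ ++ j ∷ ys′ × filter Q? ys′ ≡ ys
filter-split Q? [] [] j ys ()
filter-split Q? [] (_ ∷ _) j ys ()
filter-split Q? (c ∷ w) xs j ys eq with Q? c | filter-accept Q? {c} {w} | filter-reject Q? {c} {w}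
... | no c∉Q | _ | reject with filter-split Q? w xs j ys (trans (sym (reject c∉Q)) eq)
...   | xs′ , ys′ , refl , fys′ = c ∷ xs′ , ys′ , refl , fys′
filter-split Q? (c ∷ w) [] j ys eq | yes c∈Q | accept | _ with ∷-injective (trans (sym (accept c∈Q)) eq)
... | refl , fw = [] , w , refl , fw
filter-split Q? (c ∷ w) (x ∷ xs) j ys eq | yes c∈Q | accept | _ with ∷-injective (trans (sym (accept c∈Q)) eq)
... | refl , fw with filter-split Q? w xs j ys fw
...   | xs′ , ys′ , refl , fys′ = c ∷ xs′ , ys′ , refl , fys′

Inv-map⁻ : ∀ {f : ℕ → ℕ} → (∀ {x y} → x ≤ y → f x ≤ f y) → ∀ w {j i} → Inv (map f w) j i →
  ∃₂ λ j′ i′ → f j′ ≡ j × f i′ ≡ i × Inv w j′ i′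
Inv-map⁻ {f} mono w (i<j , xs , ys , w≡ , i∈ys) with map-split f w xs _ ys w≡
... | xs′ , j′ , ys′ , refl , refl , refl with ∈-map⁻ f i∈ys
...   | i′ , i′∈ys′ , refl with <-≤-connex i′ j′
...     | inj₁ i′<j′ = j′ , i′ , refl , refl , i′<j′ , xs′ , ys′ , refl , i′∈ys′
...     | inj₂ j′≤i′ = contradiction (mono j′≤i′) (<⇒≱ i<j)

Inv-map⁺ : ∀ {f : ℕ → ℕ} {w} → (∀ {x y} → x ∈ w → x < y → f x < f y) → ∀ {j i} → Inv w j i →
  Inv (map f w) (f j) (f i)
Inv-map⁺ {f} strict (i<j , xs , ys , refl , i∈ys) =
  strict (∈-++⁺ʳ xs (there i∈ys)) i<j , map f xs , map f ys , map-++ f xs _ , ∈-map⁺ f i∈ys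

Inv-filter⁻ : ∀ {Q : ℕ → Set} (Q? : Decidable Q) w {j i} → Inv (filter Q? w) j i → Q j × Q i × Inv w j i
Inv-filter⁻ Q? w (i<j , xs , ys , w≡ , i∈ys) with filter-split Q? w xs _ ys w≡
... | xs′ , ys′ , refl , refl with ∈-filter⁻ Q? {xs = ys′} i∈ys
...   | i∈ys′ , Qi = Qj , Qi , i<j , xs′ , ys′ , refl , i∈ys′
  where Qj = proj₂ (∈-filter⁻ Q? {xs = w} (subst (_ ∈_) (sym w≡) (∈-++⁺ʳ xs (here refl))))

Inv-filter⁺ : ∀ {Q : ℕ → Set} (Q? : Decidable Q) {w j i} → Q j → Q i → Inv w j i → Inv (filter Q? w) j i
Inv-filter⁺ Q? Qj Qi (i<j , xs , ys , refl , i∈ys) =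
  i<j , filter Q? xs , filter Q? ys , trans (filter-++ Q? xs _) (cong (filter Q? xs ++_) (filter-accept Q? Qj)) ,
  ∈-filter⁺ Q? i∈ys Qi

restrict-≤w : ∀ a b {u v} → u ≤w v → restrict a b u ≤w restrict a b v
restrict-≤w a b {u} u≤v j i inv with Inv-filter⁻ (inInterval? a b) u inv
... | j∈I , i∈I , inv-u = Inv-filter⁺ (inInterval? a b) j∈I i∈I (u≤v j i inv-u)

st-≤w : ∀ {u v} → u ↭ v → u ≤w v → st u ≤w st v
st-≤w {u} {v} u↭v u≤v j i inv with Inv-map⁻ (rank-mono u) u inv
... | j′ , i′ , refl , refl , inv-u =
  subst₂ (Inv (st v)) (rank-↭ (↭-sym u↭v) j′) (rank-↭ (↭-sym u↭v) i′)
    (Inv-map⁺ (rank-strict v) (u≤v j′ i′ inv-u))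

-- Standardized restrictions of permutations

st-↭ : ∀ {u v} → u ↭ v → st u ↭ st v
st-↭ {u} {v} u↭v = ↭-trans (map⁺ (rank u) u↭v) (↭-reflexive (map-cong (rank-↭ u↭v) v))

interval : ℕ → ℕ → List ℕ
interval s zero = []
interval s (suc k) = s ∷ interval (suc s) k

range≡interval : ∀ n → range n ≡ interval 1 n
range≡interval n = trans (map-applyUpTo id suc n) (applyUpTo-interval n suc 1 (λ _ → refl))
  where
  applyUpTo-interval : ∀ k (f : ℕ → ℕ) s → (∀ i → f i ≡ s + i) → applyUpTo f k ≡ interval s k
  applyUpTo-interval zero f s _ = refl
  applyUpTo-interval (suc k) f s f≗s+ =
    cong₂ _∷_ (trans (f≗s+ 0) (+-identityʳ s))
      (applyUpTo-interval k (f ∘ suc) (suc s) (λ i → trans (f≗s+ (suc i)) (+-suc s i)))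

restrict-interval-above : ∀ a b k {s} → b < s → restrict a b (interval s k) ≡ []
restrict-interval-above a b zero _ = refl
restrict-interval-above a b (suc k) b<s =
  trans (filter-reject (inInterval? a b) (λ s∈I → <⇒≱ b<s (proj₂ s∈I)))
    (restrict-interval-above a b k (m<n⇒m<1+n b<s))

restrict-interval-from : ∀ a b k {s} → a ≤ s → s ≤ suc b → suc b ≤ s + k →
  restrict a b (interval s k) ≡ interval s (suc b ∸ s)
restrict-interval-from a b zero {s} _ s≤b+1 b+1≤s+0
  with ≤-antisym s≤b+1 (subst (suc b ≤_) (+-identityʳ s) b+1≤s+0)
... | refl = cong (interval (suc b)) (sym (n∸n≡0 (suc b)))
restrict-interval-from a b (suc k) {s} a≤s _ b+1≤s+k+1 with s ≤? b
... | yes s≤b = begin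
  restrict a b (interval s (suc k))
    ≡⟨ filter-accept (inInterval? a b) (a≤s , s≤b) ⟩
  s ∷ restrict a b (interval (suc s) k)
    ≡⟨ cong (s ∷_) (restrict-interval-from a b k (m≤n⇒m≤1+n a≤s) (s≤s s≤b)
                      (subst (suc b ≤_) (+-suc s k) b+1≤s+k+1)) ⟩
  interval s (suc (b ∸ s))
    ≡⟨ cong (interval s) (+-∸-assoc 1 s≤b) ⟨
  interval s (suc b ∸ s) ∎
  where open ≡-Reasoning
... | no s≰b =
  trans (restrict-interval-above a b (suc k) (≰⇒> s≰b)) (cong (interval s) (sym (m≤n⇒m∸n≡0 (≰⇒> s≰b))))

restrict-interval : ∀ a b k {s} → s ≤ a → a ≤ b → suc b ≤ s + k →
  restrict a b (interval s k) ≡ interval a (suc b ∸ a)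
restrict-interval a b zero {s} s≤a a≤b b+1≤s+0 =
  contradiction a≤b (<⇒≱ (≤-trans (subst (suc b ≤_) (+-identityʳ s) b+1≤s+0) s≤a))
restrict-interval a b (suc k) {s} s≤a a≤b b+1≤s+k+1 with s <? a
... | yes s<a =
  trans (filter-reject (inInterval? a b) (λ s∈I → <⇒≱ s<a (proj₁ s∈I)))
    (restrict-interval a b k s<a a≤b (subst (suc b ≤_) (+-suc s k) b+1≤s+k+1))
... | no s≮a with ≤-antisym s≤a (≮⇒≥ s≮a)
...   | refl = restrict-interval-from s b (suc k) ≤-refl (m≤n⇒m≤1+n a≤b) b+1≤s+k+1

rank-interval-below : ∀ k {s x} → x ≤ s → rank (interval s k) x ≡ 1
rank-interval-below zero _ = refl
rank-interval-below (suc k) x≤s =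
  trans (rank-∷-≮ _ (λ s<x → <⇒≱ s<x x≤s)) (rank-interval-below k (m≤n⇒m≤1+n x≤s))

rank-interval : ∀ s k {x} → s ≤ x → x ≤ s + k → rank (interval s k) x ≡ suc (x ∸ s)
rank-interval s zero {x} s≤x x≤s+0 with ≤-antisym s≤x (subst (x ≤_) (+-identityʳ s) x≤s+0)
... | refl = cong suc (sym (n∸n≡0 s))
rank-interval s (suc k) {x} s≤x x≤s+k+1 with s <? x
... | yes s<x = begin
  rank (s ∷ interval (suc s) k) x    ≡⟨ rank-∷-< _ s<x ⟩
  suc (rank (interval (suc s) k) x)  ≡⟨ cong suc (rank-interval (suc s) k s<x x≤s+1+k) ⟩
  suc (suc (x ∸ suc s))              ≡⟨ cong suc (+-∸-assoc 1 s<x) ⟨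
  suc (x ∸ s)                        ∎
  where
  open ≡-Reasoning
  x≤s+1+k = subst (x ≤_) (+-suc s k) x≤s+k+1
... | no s≮x with ≤-antisym s≤x (≮⇒≥ s≮x)
...   | refl = trans (rank-∷-≮ _ s≮x) (trans (rank-interval-below k (n≤1+n s)) (cong suc (sym (n∸n≡0 s))))

map-rank-interval : ∀ a m k {s} → a ≤ s → s + k ≤ a + m →
  map (rank (interval a m)) (interval s k) ≡ interval (suc (s ∸ a)) k
map-rank-interval a m zero _ _ = refl
map-rank-interval a m (suc k) {s} a≤s s+k+1≤a+m =
  cong₂ _∷_ (rank-interval a m a≤s (≤-trans (m≤m+n s (suc k)) s+k+1≤a+m))
    (trans (map-rank-interval a m k (m≤n⇒m≤1+n a≤s) (subst (_≤ a + m) (+-suc s k) s+k+1≤a+m))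
      (cong (λ d → interval (suc d) k) (+-∸-assoc 1 a≤s)))

st-interval : ∀ a m → st (interval a m) ≡ range m
st-interval a m = begin
  map (rank (interval a m)) (interval a m)  ≡⟨ map-rank-interval a m m ≤-refl ≤-refl ⟩
  interval (suc (a ∸ a)) m                  ≡⟨ cong (λ d → interval (suc d) m) (n∸n≡0 a) ⟩
  interval 1 m                              ≡⟨ range≡interval m ⟨
  range m                                   ∎
  where open ≡-Reasoning

st-restrict-range : ∀ {n a b} → 1 ≤ a → a ≤ b → b ≤ n → st (restrict a b (range n)) ≡ range (suc b ∸ a)
st-restrict-range {n} {a} {b} 1≤a a≤b b≤n = begin
  st (restrict a b (range n))         ≡⟨ cong (st ∘ restrict a b) (range≡interval n) ⟩
  st (restrict a b (interval 1 n))    ≡⟨ cong st (restrict-interval a b n 1≤a a≤b (s≤s b≤n)) ⟩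
  st (interval a (suc b ∸ a))         ≡⟨ st-interval a (suc b ∸ a) ⟩
  range (suc b ∸ a)                   ∎
  where open ≡-Reasoning

IsPerm-st-restrict : ∀ {n a b u} → 1 ≤ a → a ≤ b → b ≤ n → IsPerm n u →
  IsPerm (suc b ∸ a) (st (restrict a b u))
IsPerm-st-restrict {a = a} {b} 1≤a a≤b b≤n u↭range =
  ↭-trans (st-↭ (filter-↭ (inInterval? a b) u↭range)) (↭-reflexive (st-restrict-range 1≤a a≤b b≤n))

-- The Taskin order

module _ {n a b : ℕ} (1≤a : 1 ≤ a) (a≤b : a ≤ b) (b≤n : b ≤ n) where

  TaskinStep-restrict : ∀ {A B} u v → TaskinStep n A B → P u ≡ A → P v ≡ B →
    TaskinStep (suc b ∸ a) (P (st (restrict a b u))) (P (st (restrict a b v)))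
  TaskinStep-restrict u v (u₀ , v₀ , u₀↭range , v₀↭range , u₀≤v₀ , refl , refl) Pu≡Pu₀ Pv≡Pv₀ =
    st (restrict a b u₀) , st (restrict a b v₀) ,
    IsPerm-st-restrict 1≤a a≤b b≤n u₀↭range , IsPerm-st-restrict 1≤a a≤b b≤n v₀↭range ,
    st-≤w (filter-↭ (inInterval? a b) (↭-trans u₀↭range (↭-sym v₀↭range))) (restrict-≤w a b u₀≤v₀) ,
    P-st-restrict a b u₀ u (sym Pu≡Pu₀) , P-st-restrict a b v₀ v (sym Pv≡Pv₀)

  TaskinLeq-restrict : ∀ {A B} u v → TaskinLeq n A B → P u ≡ A → P v ≡ B →
    TaskinLeq (suc b ∸ a) (P (st (restrict a b u))) (P (st (restrict a b v)))
  TaskinLeq-restrict u v [ A≤B ] Pu≡A Pv≡B = [ TaskinStep-restrict u v A≤B Pu≡A Pv≡B ]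
  TaskinLeq-restrict u v (A≤C@(_ , w , _ , _ , _ , _ , Pw≡C) ∷ C≤B) Pu≡A Pv≡B =
    TaskinStep-restrict u w A≤C Pu≡A Pw≡C ∷ TaskinLeq-restrict w v C≤B Pw≡C Pv≡B

lemma4p3 : (n : ℕ) (A B : Tableau) → SYT n A → SYT n B → TaskinLeq n A B →
    (a b : ℕ) → 1 ≤ a → a ≤ b → b ≤ n →
    (u v : Word) → IsPerm n u → IsPerm n v → P u ≡ A → P v ≡ B →
    TaskinLeq (suc b ∸ a) (P (st (restrict a b u))) (P (st (restrict a b v)))
lemma4p3 n A B _ _ A≤B a b 1≤a a≤b b≤n u v _ _ Pu≡A Pv≡B =
  TaskinLeq-restrict 1≤a a≤b b≤n u v A≤B Pu≡A Pv≡B
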